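{- Let $R$ be a commutative ring, let $n \geq 3$ be odd, let $l \geq 1$ and $m \geq 3$ be integers, and let $A \in R^{l \times n}$ and $B \in R^{n \times m}$. Then: (i) if $m$ is odd, the product $AB$ can be computed using $n(lm + l + m - 1)/2$ multiplications; (ii) if $m$ is even, the product $AB$ can be computed using $(n(lm + l + m - 1) + l - 1)/2$ multiplications.
   Context: "Computed using $k$ multiplications" means: there are $k$ products $q_1,\dots,q_k$, each of the form $q_t = L_t \cdot L'_t$ where $L_t, L'_t$ are linear combinations with integer coefficients of the entries of $A$ and of $B$ (entries of $A$ and $B$ may be mixed within one factor, which is allowed because $R$ is commutative), such that every entry of $AB$ equals an integer linear combination of $q_1,\dots,q_k$, identically for all matrices $A$, $B$ of the given sizes over $R$. Only these $k$ ring multiplications are counted; additions, subtractions and multiplications by integer constants are not counted. -}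

module Defs where

open import Level using (Level)
open import Data.Nat using (ℕ; suc)
open import Data.Integer using (ℤ; +_; -[1+_])
open import Data.Fin using (Fin)
open import Data.Product using (Σ)
open import Algebra.Bundles using (CommutativeRing)
import Algebra.Definitions.RawMonoid as RawMonoidDefs

-- A bilinear-free "k-multiplication scheme" for l×n times n×m matrices.
-- All coefficients are integers and the data is independent of the ring.
record Scheme (l n m k : ℕ) : Set where
  field
    -- L_t = Σ_{i,r} α t i r · A i r  +  Σ_{r,j} β t r j · B r j
    α  : Fin k → Fin l → Fin n → ℤ
    β  : Fin k → Fin n → Fin m → ℤ
    -- L'_t = Σ_{i,r} α' t i r · A i r  +  Σ_{r,j} β' t r j · B r j
    α' : Fin k → Fin l → Fin n → ℤ
    β' : Fin k → Fin n → Fin m → ℤ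
    -- (AB)_{ij} = Σ_t γ i j t · q_t
    γ  : Fin l → Fin m → Fin k → ℤ

module _ {c ℓ : Level} (R : CommutativeRing c ℓ) where
  open CommutativeRing R
  open RawMonoidDefs +-rawMonoid using (_×_; sum)

  ι : ℤ → Carrier
  ι (+ n)     = n × 1#
  ι -[1+ n ]  = - (suc n × 1#)

  Mat : ℕ → ℕ → Set c
  Mat p q = Fin p → Fin q → Carrier

  matMul : ∀ {l n m} → Mat l n → Mat n m → Mat l m
  matMul {n = n} A B i j = sum (λ r → A i r * B r j)

  linComb : ∀ {l n m} → (Fin l → Fin n → ℤ) → (Fin n → Fin m → ℤ)
            → Mat l n → Mat n m → Carrier
  linComb a b A B =
    sum (λ i → sum (λ r → ι (a i r) * A i r)) +
    sum (λ r → sum (λ j → ι (b r j) * B r j))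

  Computes : ∀ {l n m k} → Scheme l n m k → Set (c Level.⊔ ℓ)
  Computes {l} {n} {m} {k} S =
    (A : Mat l n) (B : Mat n m) (i : Fin l) (j : Fin m) →
    matMul A B i j ≈
      sum (λ t → ι (γ i j t) *
                 (linComb (α t) (β t) A B * linComb (α' t) (β' t) A B))
    where open Scheme S

  ComputableWith : ℕ → ℕ → ℕ → ℕ → Set (c Level.⊔ ℓ)
  ComputableWith l n m k = Σ (Scheme l n m k) Computes

-- Over a commutative ring, for a row x of A and columns j, j′ of B,
--   (x_r - B[s,j]) (x_s - B[r,j′]) - B[s,j] B[r,j′] = x_r x_s - x_r B[r,j′] - x_s B[s,j],
-- so one product per row of A together with one product shared by all rows yields two terms of AB,
-- up to the term x_r x_s, which another product per row cancels.  Splitting the inner dimension as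
-- n = 3 + 2 + ⋯ + 2 reduces the theorem to inner dimensions 2 and 3.  With w = lm + l + m - 1, inner
-- dimension 2 costs w multiplications.  Inner dimension 3 costs 6l + 3 for three columns, and each
-- further pair of columns only 3l + 3, because it perturbs the products already formed for three
-- anchor columns; this gives 3w/2 for odd m, and one last column at cost 2l + 1 gives
-- (3w + l - 1)/2 for even m.  The blocks add up to ((n - 3)/2) w + 3w/2 = nw/2.
module Submission where

open import Defs
open import Level using (Level; _⊔_)
open import Algebra.Bundles using (CommutativeRing)
import Algebra.Solver.Ring as RingSolver
open import Algebra.Solver.Ring.AlmostCommutativeRing
  using (fromCommutativeRing; _-Raw-AlmostCommutative⟶_)
import Data.Nat as ℕ
open ℕ using (ℕ; zero; suc)
import Data.Nat.Properties as ℕ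
import Data.Integer as ℤ
open ℤ using (ℤ; +_; -[1+_])
import Data.Integer.Properties as ℤ
open import Data.Fin using (Fin; zero; suc; _↑ˡ_; _↑ʳ_)
open import Data.Product using (Σ; _×_; _,_; proj₁; proj₂)
open import Data.Vec using (Vec; _∷_; []; _++_; lookup; map; tabulate; concat)
open import Data.Vec.Membership.Propositional using (_∈_)
open import Data.Vec.Membership.Propositional.Properties using (∈-++⁺ˡ; ∈-++⁺ʳ; ∈-map⁺; ∈-tabulate⁺)
import Data.Vec.Relation.Unary.Any as Any
open Any using (here; there)
open import Data.Vec.Relation.Unary.Any.Properties using (lookup-index; concat⁺; tabulate⁺)
open import Data.Fin.Patterns using (0F; 1F; 2F)
open import Data.Maybe using (Maybe; just; nothing)
open import Relation.Binary.PropositionalEquality as ≡ using (_≡_)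
open import Relation.Nullary using (yes; no)
open import Function using (_∘_)

pattern #0 = here ≡.refl
pattern #1 = there #0
pattern #2 = there #1
pattern #3 = there #2
pattern #4 = there #3
pattern #5 = there #4

module Counting where

  open import Data.Nat
  open import Data.Nat.Properties
  open import Data.Nat.DivMod using (_/_; _%_; m≡m%n+[m/n]*n; m*n/n≡m)
  open import Data.Nat.Tactic.RingSolver using (solve-∀)
  open import Data.Product using (∃-syntax)
  open import Relation.Binary.PropositionalEquality
  open import Relation.Nullary.Negation using (contradiction)
  open ≡-Reasoning

  pairCost : ℕ → ℕ → ℕ
  pairCost l m = l * m + l + m ∸ 1

  pairCost-suc : ∀ l m → pairCost l (suc m) ≡ l * suc m + l + m
  pairCost-suc l m = cong (_∸ 1) (+-suc (l * suc m + l) m)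

  odd≥3⇒3+2p : ∀ n → n % 2 ≡ 1 → 3 ≤ n → ∃[ p ] n ≡ 3 + p * 2
  odd≥3⇒3+2p n n-odd 3≤n with n / 2 | m≡m%n+[m/n]*n n 2
  ... | zero  | n≡ rewrite n-odd = contradiction (subst (3 ≤_) n≡ 3≤n) λ { (s≤s ()) }
  ... | suc p | n≡ rewrite n-odd = p , n≡

  even≥3⇒4+2q : ∀ n → n % 2 ≡ 0 → 3 ≤ n → ∃[ q ] n ≡ 4 + q * 2
  even≥3⇒4+2q n n-even 3≤n with n / 2 | m≡m%n+[m/n]*n n 2
  ... | zero        | n≡ rewrite n-even = contradiction (subst (3 ≤_) n≡ 3≤n) λ ()
  ... | suc zero    | n≡ rewrite n-even = contradiction (subst (3 ≤_) n≡ 3≤n) λ { (s≤s (s≤s ())) }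
  ... | suc (suc q) | n≡ rewrite n-even = q , n≡

  anchoredCost : ℕ → ℕ → ℕ
  anchoredCost l zero    = l * 6 + 3
  anchoredCost l (suc q) = anchoredCost l q + (l * 3 + 3)

  extendedCost : ℕ → ℕ → ℕ
  extendedCost l q = anchoredCost l q + (l * 2 + 1)

  twice-anchoredCost : ∀ l q → 2 * anchoredCost l q ≡ 3 * pairCost l (3 + q * 2)
  twice-anchoredCost l q = trans (closed l q) (cong (3 *_) (sym (pairCost-suc l (2 + q * 2))))
    where
    closed : ∀ l q → 2 * anchoredCost l q ≡ 3 * (l * (3 + q * 2) + l + (2 + q * 2))
    closed l zero    = base l
      where
      base : ∀ l → 2 * (l * 6 + 3) ≡ 3 * (l * 3 + l + 2)
      base = solve-∀
    closed l (suc q) = begin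
      2 * (anchoredCost l q + (l * 3 + 3))                      ≡⟨ *-distribˡ-+ 2 (anchoredCost l q) _ ⟩
      2 * anchoredCost l q + 2 * (l * 3 + 3)                    ≡⟨ cong (_+ 2 * (l * 3 + 3)) (closed l q) ⟩
      3 * (l * (3 + q * 2) + l + (2 + q * 2)) + 2 * (l * 3 + 3) ≡⟨ step l q ⟩
      3 * (l * (3 + suc q * 2) + l + (2 + suc q * 2))           ∎
      where
      step : ∀ l q → 3 * (l * (3 + q * 2) + l + (2 + q * 2)) + 2 * (l * 3 + 3)
                   ≡ 3 * (l * (3 + suc q * 2) + l + (2 + suc q * 2))
      step = solve-∀

  twice-extendedCost : ∀ l q → 1 ≤ l → 2 * extendedCost l q ≡ 3 * pairCost l (4 + q * 2) + (l ∸ 1)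
  twice-extendedCost l@(suc l′) q _ = begin
    2 * (anchoredCost l q + (l * 2 + 1))
      ≡⟨ *-distribˡ-+ 2 (anchoredCost l q) _ ⟩
    2 * anchoredCost l q + 2 * (l * 2 + 1)
      ≡⟨ cong (_+ 2 * (l * 2 + 1)) (twice-anchoredCost l q) ⟩
    3 * pairCost l (3 + q * 2) + 2 * (l * 2 + 1)
      ≡⟨ cong (λ w → 3 * w + 2 * (l * 2 + 1)) (pairCost-suc l (2 + q * 2)) ⟩
    3 * (l * (3 + q * 2) + l + (2 + q * 2)) + 2 * (l * 2 + 1)
      ≡⟨ step l′ q ⟩
    3 * (l * (4 + q * 2) + l + (3 + q * 2)) + l′
      ≡⟨ cong (λ w → 3 * w + l′) (pairCost-suc l (3 + q * 2)) ⟨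
    3 * pairCost l (4 + q * 2) + l′ ∎
    where
    step : ∀ l′ q → 3 * (suc l′ * (3 + q * 2) + suc l′ + (2 + q * 2)) + 2 * (suc l′ * 2 + 1)
                  ≡ 3 * (suc l′ * (4 + q * 2) + suc l′ + (3 + q * 2)) + l′
    step = solve-∀

  inner₂-cost : ∀ l m → l * (2 + m) + m ≡ pairCost l (suc m)
  inner₂-cost l m = trans (arith l m) (sym (pairCost-suc l m))
    where
    arith : ∀ l m → l * (2 + m) + m ≡ l * suc m + l + m
    arith = solve-∀

  stackCost : ∀ p w k e → 2 * k ≡ 3 * w + e → p * w + k ≡ ((3 + p * 2) * w + e) / 2
  stackCost p w k e 2k≡ = sym (trans (cong (_/ 2) doubled) (m*n/n≡m (p * w + k) 2))
    where
    doubled : (3 + p * 2) * w + e ≡ (p * w + k) * 2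
    doubled = begin
      (3 + p * 2) * w + e      ≡⟨ arith₁ p w e ⟩
      p * w * 2 + (3 * w + e)  ≡⟨ cong (λ x → p * w * 2 + x) 2k≡ ⟨
      p * w * 2 + 2 * k        ≡⟨ arith₂ p w k ⟩
      (p * w + k) * 2          ∎
      where
      arith₁ : ∀ p w e → (3 + p * 2) * w + e ≡ p * w * 2 + (3 * w + e)
      arith₁ = solve-∀
      arith₂ : ∀ p w k → p * w * 2 + 2 * k ≡ (p * w + k) * 2
      arith₂ = solve-∀

  stackCost-odd : ∀ p {w k} → 2 * k ≡ 3 * w → p * w + k ≡ ((3 + p * 2) * w) / 2
  stackCost-odd p {w} {k} 2k≡3w =
    trans (stackCost p w k 0 (trans 2k≡3w (sym (+-identityʳ _)))) (cong (_/ 2) (+-identityʳ ((3 + p * 2) * w)))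

  stackCost-even : ∀ p {l w k} → 1 ≤ l → 2 * k ≡ 3 * w + (l ∸ 1) →
                   p * w + k ≡ ((3 + p * 2) * w + l ∸ 1) / 2
  stackCost-even p {l} {w} {k} 1≤l 2k≡ =
    trans (stackCost p w k (l ∸ 1) 2k≡) (cong (_/ 2) (sym (+-∸-assoc ((3 + p * 2) * w) 1≤l)))

open Counting

δ : ∀ {n} → Fin n → Fin n → ℤ
δ zero    zero    = + 1
δ zero    (suc _) = + 0
δ (suc _) zero    = + 0
δ (suc i) (suc j) = δ i j

infixl 6 _⊕_ _⊖_
infix  7 ⊝_

data Form (l n m : ℕ) : Set where
  a   : Fin l → Fin n → Form l n m
  b   : Fin n → Fin m → Form l n m
  _⊕_ : Form l n m → Form l n m → Form l n m
  ⊝_  : Form l n m → Form l n m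

_⊖_ : ∀ {l n m} → Form l n m → Form l n m → Form l n m
e ⊖ f = e ⊕ ⊝ f

Multiplication : ℕ → ℕ → ℕ → Set
Multiplication l n m = Form l n m × Form l n m

coeffᴬ : ∀ {l n m} → Form l n m → Fin l → Fin n → ℤ
coeffᴬ (a i r)  i′ r′ = δ i i′ ℤ.* δ r r′
coeffᴬ (b _ _)  _  _  = + 0
coeffᴬ (e ⊕ f)  i  r  = coeffᴬ e i r ℤ.+ coeffᴬ f i r
coeffᴬ (⊝ e)    i  r  = ℤ.- coeffᴬ e i r

coeffᴮ : ∀ {l n m} → Form l n m → Fin n → Fin m → ℤ
coeffᴮ (a _ _)  _  _  = + 0
coeffᴮ (b r j)  r′ j′ = δ r r′ ℤ.* δ j j′
coeffᴮ (e ⊕ f)  r  j  = coeffᴮ e r j ℤ.+ coeffᴮ f r j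
coeffᴮ (⊝ e)    r  j  = ℤ.- coeffᴮ e r j

module _ {l n m l′ n′ m′ : ℕ}
         (fi : Fin l → Fin l′) (fr : Fin n → Fin n′) (fj : Fin m → Fin m′) where

  rename : Form l n m → Form l′ n′ m′
  rename (a i r) = a (fi i) (fr r)
  rename (b r j) = b (fr r) (fj j)
  rename (e ⊕ f) = rename e ⊕ rename f
  rename (⊝ e)   = ⊝ rename e

  renameₘ : Multiplication l n m → Multiplication l′ n′ m′
  renameₘ (e , f) = rename e , rename f

module _ {l n m : ℕ} (S : Fin n → Fin m) where

  cross : Fin l → Fin n → Fin n → Multiplication l n m
  cross i r s = a i r ⊖ b s (S r) , a i s ⊖ b r (S s)

  shared : Fin n → Fin n → Multiplication l n m
  shared r s = b s (S r) , b r (S s)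

  perturbed : Fin l → Fin n → Fin n → Form l n m → Form l n m → Multiplication l n m
  perturbed i r s u v = a i r ⊖ b s (S r) ⊕ u , a i s ⊖ b r (S s) ⊕ v

  sharedPerturbed : Fin n → Fin n → Form l n m → Form l n m → Multiplication l n m
  sharedPerturbed r s u v = b s (S r) ⊖ u , b r (S s) ⊖ v

module IntegerEmbedding {c ℓ : Level} (R : CommutativeRing c ℓ) where
  open CommutativeRing R hiding (zero)
  open import Algebra.Properties.Ring ring using (-‿distribˡ-*; -‿distribʳ-*; -‿involutive; -0#≈0#; -‿+-comm)
  open import Algebra.Properties.CommutativeSemigroup +-commutativeSemigroup using (interchange)
  open import Algebra.Properties.Monoid.Mult +-monoid using (×-homo-+)
  open import Algebra.Properties.Semiring.Mult semiring using (×1-homo-*)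
  open import Relation.Binary.Reasoning.Setoid setoid

  ι-⊖ : ∀ m n → ι R (m ℤ.⊖ n) ≈ ι R (+ m) - ι R (+ n)
  ι-⊖ zero    zero    = sym (-‿inverseʳ 0#)
  ι-⊖ (suc m) zero    = sym (trans (+-congˡ -0#≈0#) (+-identityʳ _))
  ι-⊖ zero    (suc n) = sym (+-identityˡ _)
  ι-⊖ (suc m) (suc n) = begin
    ι R (suc m ℤ.⊖ suc n)                   ≡⟨ ≡.cong (ι R) (ℤ.[1+m]⊖[1+n]≡m⊖n m n) ⟩
    ι R (m ℤ.⊖ n)                           ≈⟨ ι-⊖ m n ⟩
    x - y                                   ≈⟨ +-identityˡ _ ⟨
    0# + (x - y)                            ≈⟨ +-congʳ (-‿inverseʳ 1#) ⟨
    (1# - 1#) + (x - y)                     ≈⟨ interchange 1# (- 1#) x (- y) ⟩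
    (1# + x) + (- 1# - y)                   ≈⟨ +-congˡ (-‿+-comm 1# y) ⟩
    (1# + x) - (1# + y)                     ∎
    where
    x = ι R (+ m)
    y = ι R (+ n)

  ι-homo-+ : ∀ x y → ι R (x ℤ.+ y) ≈ ι R x + ι R y
  ι-homo-+ (+ m)    (+ n)    = ×-homo-+ 1# m n
  ι-homo-+ (+ m)    -[1+ n ] = ι-⊖ m (suc n)
  ι-homo-+ -[1+ m ] (+ n)    = trans (ι-⊖ n (suc m)) (+-comm _ _)
  ι-homo-+ -[1+ m ] -[1+ n ] = begin
    - ι R (+ suc (suc (m ℕ.+ n)))                ≡⟨ ≡.cong (λ k → - ι R (+ k)) (ℕ.+-suc (suc m) n) ⟨
    - ι R (+ (suc m ℕ.+ suc n))                  ≈⟨ -‿cong (×-homo-+ 1# (suc m) (suc n)) ⟩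
    - (ι R (+ suc m) + ι R (+ suc n))            ≈⟨ -‿+-comm _ _ ⟨
    - ι R (+ suc m) - ι R (+ suc n)              ∎

  ι-homo-‿ : ∀ x → ι R (ℤ.- x) ≈ - ι R x
  ι-homo-‿ (+ zero)  = sym -0#≈0#
  ι-homo-‿ (+ suc n) = refl
  ι-homo-‿ -[1+ n ]  = sym (-‿involutive _)

  ι-homo-*-+ : ∀ m y → ι R (+ m ℤ.* y) ≈ ι R (+ m) * ι R y
  ι-homo-*-+ m (+ n)    = trans (reflexive (≡.cong (ι R) (≡.sym (ℤ.pos-* m n)))) (×1-homo-* m n)
  ι-homo-*-+ m -[1+ n ] = begin
    ι R (+ m ℤ.* ℤ.- + suc n)          ≡⟨ ≡.cong (ι R) (ℤ.neg-distribʳ-* (+ m) (+ suc n)) ⟨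
    ι R (ℤ.- (+ m ℤ.* + suc n))        ≈⟨ ι-homo-‿ (+ m ℤ.* + suc n) ⟩
    - ι R (+ m ℤ.* + suc n)            ≈⟨ -‿cong (ι-homo-*-+ m (+ suc n)) ⟩
    - (ι R (+ m) * ι R (+ suc n))      ≈⟨ -‿distribʳ-* _ _ ⟩
    ι R (+ m) * - ι R (+ suc n)        ∎

  ι-homo-* : ∀ x y → ι R (x ℤ.* y) ≈ ι R x * ι R y
  ι-homo-* (+ m)    y = ι-homo-*-+ m y
  ι-homo-* -[1+ m ] y = begin
    ι R (ℤ.- + suc m ℤ.* y)            ≡⟨ ≡.cong (ι R) (ℤ.neg-distribˡ-* (+ suc m) y) ⟨
    ι R (ℤ.- (+ suc m ℤ.* y))          ≈⟨ ι-homo-‿ (+ suc m ℤ.* y) ⟩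
    - ι R (+ suc m ℤ.* y)              ≈⟨ -‿cong (ι-homo-*-+ (suc m) y) ⟩
    - (ι R (+ suc m) * ι R y)          ≈⟨ -‿distribˡ-* _ _ ⟩
    - ι R (+ suc m) * ι R y            ∎

  ι-morphism : CommutativeRing.rawRing ℤ.+-*-commutativeRing
                 -Raw-AlmostCommutative⟶ fromCommutativeRing R
  ι-morphism = record
    { ⟦_⟧    = ι R
    ; +-homo = ι-homo-+
    ; *-homo = ι-homo-*
    ; -‿homo = ι-homo-‿
    ; 0-homo = refl
    ; 1-homo = +-identityʳ 1#
    }

  ι-≟ : ∀ x y → Maybe (ι R x ≈ ι R y)
  ι-≟ x y with x ℤ.≟ y
  ... | yes ≡.refl = just refl
  ... | no _       = nothing

module Algorithms {c ℓ : Level} (R : CommutativeRing c ℓ) where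
  open CommutativeRing R hiding (zero)
  open IntegerEmbedding R
  open RingSolver _ _ ι-morphism ι-≟ using (solve; _:=_; _:+_; _:-_; _:*_; con)
  open import Algebra.Properties.Ring ring using (-‿distribˡ-*; -‿+-comm; -0#≈0#)
  open import Algebra.Properties.CommutativeSemigroup +-commutativeSemigroup using (interchange)
  open import Algebra.Properties.Semiring.Sum semiring
    using (sum; sum-cong-≋; ∑-distrib-+; *-distribˡ-sum; sum-replicate-zero)
  open import Relation.Binary.Reasoning.Setoid setoid

  sum-‿ : ∀ {k} (f : Fin k → Carrier) → sum (λ t → - f t) ≈ - sum f
  sum-‿ {zero}  f = sym -0#≈0#
  sum-‿ {suc k} f = trans (+-congˡ (sum-‿ (λ t → f (suc t)))) (-‿+-comm _ _)

  sum-↑ : ∀ k₁ {k₂} (f : Fin (k₁ ℕ.+ k₂) → Carrier) →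
          sum f ≈ sum (λ t → f (t ↑ˡ k₂)) + sum (λ t → f (k₁ ↑ʳ t))
  sum-↑ zero    f = sym (+-identityˡ _)
  sum-↑ (suc k₁) f = trans (+-congˡ (sum-↑ k₁ (λ t → f (suc t)))) (sym (+-assoc _ _ _))

  infix 8 _·_

  _·_ : ∀ {k} → (Fin k → ℤ) → (Fin k → Carrier) → Carrier
  γ · f = sum (λ t → ι R (γ t) * f t)

  ·-homo-+ : ∀ {k} (γ γ′ : Fin k → ℤ) f → (λ t → γ t ℤ.+ γ′ t) · f ≈ γ · f + γ′ · f
  ·-homo-+ γ γ′ f = trans (sum-cong-≋ λ t → trans (*-congʳ (ι-homo-+ (γ t) (γ′ t))) (distribʳ _ _ _))
                          (∑-distrib-+ (λ t → ι R (γ t) * f t) (λ t → ι R (γ′ t) * f t))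

  ·-homo-‿ : ∀ {k} (γ : Fin k → ℤ) f → (λ t → ℤ.- γ t) · f ≈ - (γ · f)
  ·-homo-‿ γ f = trans (sum-cong-≋ λ t → trans (*-congʳ (ι-homo-‿ (γ t))) (sym (-‿distribˡ-* _ _)))
                       (sum-‿ (λ t → ι R (γ t) * f t))

  ·-scale : ∀ {k} z (γ : Fin k → ℤ) f → (λ t → z ℤ.* γ t) · f ≈ ι R z * (γ · f)
  ·-scale z γ f = trans (sum-cong-≋ λ t → trans (*-congʳ (ι-homo-* z (γ t))) (*-assoc _ _ _))
                        (sym (*-distribˡ-sum (ι R z) (λ t → ι R (γ t) * f t)))

  0-· : ∀ {k} (f : Fin k → Carrier) → (λ _ → + 0) · f ≈ 0#
  0-· {k} f = trans (sum-cong-≋ λ t → zeroˡ (f t)) (sum-replicate-zero k)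

  δ-· : ∀ {k} (i : Fin k) f → δ i · f ≈ f i
  δ-· zero    f = trans (+-cong (*-congʳ (+-identityʳ 1#)) (0-· (λ t → f (suc t))))
                        (trans (+-identityʳ _) (*-identityˡ _))
  δ-· (suc i) f = trans (+-cong (zeroˡ (f zero)) (δ-· i (λ t → f (suc t)))) (+-identityˡ _)

  Σ· : ∀ {p q} → (Fin p → Fin q → ℤ) → (Fin p → Fin q → Carrier) → Carrier
  Σ· T F = sum (λ i → T i · F i)

  Σ·-homo-+ : ∀ {p q} (T T′ : Fin p → Fin q → ℤ) F →
              Σ· (λ i j → T i j ℤ.+ T′ i j) F ≈ Σ· T F + Σ· T′ F
  Σ·-homo-+ T T′ F = trans (sum-cong-≋ λ i → ·-homo-+ (T i) (T′ i) (F i))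
                           (∑-distrib-+ (λ i → T i · F i) (λ i → T′ i · F i))

  Σ·-homo-‿ : ∀ {p q} (T : Fin p → Fin q → ℤ) F → Σ· (λ i j → ℤ.- T i j) F ≈ - Σ· T F
  Σ·-homo-‿ T F = trans (sum-cong-≋ λ i → ·-homo-‿ (T i) (F i)) (sum-‿ (λ i → T i · F i))

  Σ·-0 : ∀ {p q} (F : Fin p → Fin q → Carrier) → Σ· (λ _ _ → + 0) F ≈ 0#
  Σ·-0 {p} F = trans (sum-cong-≋ λ i → 0-· (F i)) (sum-replicate-zero p)

  Σ·-δ : ∀ {p q} (i : Fin p) (j : Fin q) F → Σ· (λ i′ j′ → δ i i′ ℤ.* δ j j′) F ≈ F i j
  Σ·-δ i j F = begin
    sum (λ i′ → (λ j′ → δ i i′ ℤ.* δ j j′) · F i′) ≈⟨ sum-cong-≋ (λ i′ → ·-scale (δ i i′) (δ j) (F i′)) ⟩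
    sum (λ i′ → ι R (δ i i′) * (δ j · F i′))       ≈⟨ sum-cong-≋ (λ i′ → *-congˡ (δ-· j (F i′))) ⟩
    δ i · (λ i′ → F i′ j)                          ≈⟨ δ-· i (λ i′ → F i′ j) ⟩
    F i j                                          ∎

  module _ {l n m : ℕ} where

    ⟦_⟧ : Form l n m → Mat R l n → Mat R n m → Carrier
    ⟦ a i r ⟧ A B = A i r
    ⟦ b r j ⟧ A B = B r j
    ⟦ e ⊕ f ⟧ A B = ⟦ e ⟧ A B + ⟦ f ⟧ A B
    ⟦ ⊝ e   ⟧ A B = - ⟦ e ⟧ A B

    ⟦_⟧ₘ : Multiplication l n m → Mat R l n → Mat R n m → Carrier
    ⟦ e , f ⟧ₘ A B = ⟦ e ⟧ A B * ⟦ f ⟧ A B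

    linComb-coeff : ∀ e A B → linComb R (coeffᴬ e) (coeffᴮ e) A B ≈ ⟦ e ⟧ A B
    linComb-coeff (a i r) A B = trans (+-cong (Σ·-δ i r A) (Σ·-0 B)) (+-identityʳ _)
    linComb-coeff (b r j) A B = trans (+-cong (Σ·-0 A) (Σ·-δ r j B)) (+-identityˡ _)
    linComb-coeff (e ⊕ f) A B = begin
      Σ· (λ i r → coeffᴬ e i r ℤ.+ coeffᴬ f i r) A + Σ· (λ r j → coeffᴮ e r j ℤ.+ coeffᴮ f r j) B
        ≈⟨ +-cong (Σ·-homo-+ (coeffᴬ e) (coeffᴬ f) A) (Σ·-homo-+ (coeffᴮ e) (coeffᴮ f) B) ⟩
      (Σ· (coeffᴬ e) A + Σ· (coeffᴬ f) A) + (Σ· (coeffᴮ e) B + Σ· (coeffᴮ f) B)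
        ≈⟨ interchange _ _ _ _ ⟩
      linComb R (coeffᴬ e) (coeffᴮ e) A B + linComb R (coeffᴬ f) (coeffᴮ f) A B
        ≈⟨ +-cong (linComb-coeff e A B) (linComb-coeff f A B) ⟩
      ⟦ e ⟧ A B + ⟦ f ⟧ A B ∎
    linComb-coeff (⊝ e) A B = begin
      Σ· (λ i r → ℤ.- coeffᴬ e i r) A + Σ· (λ r j → ℤ.- coeffᴮ e r j) B
        ≈⟨ +-cong (Σ·-homo-‿ (coeffᴬ e) A) (Σ·-homo-‿ (coeffᴮ e) B) ⟩
      - Σ· (coeffᴬ e) A - Σ· (coeffᴮ e) B
        ≈⟨ -‿+-comm _ _ ⟩
      - linComb R (coeffᴬ e) (coeffᴮ e) A B
        ≈⟨ -‿cong (linComb-coeff e A B) ⟩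
      - ⟦ e ⟧ A B ∎

    infixl 6 _⊞_ _⊟_
    infix  7 ⊟_

    data Span {k} (V : Vec (Multiplication l n m) k) : (Mat R l n → Mat R n m → Carrier) → Set (c ⊔ ℓ) where
      gen  : ∀ {p} → p ∈ V → Span V ⟦ p ⟧ₘ
      _⊞_  : ∀ {f g} → Span V f → Span V g → Span V (λ A B → f A B + g A B)
      ⊟_   : ∀ {f} → Span V f → Span V (λ A B → - f A B)
      resp : ∀ {f g} → (∀ A B → f A B ≈ g A B) → Span V f → Span V g

    _⊟_ : ∀ {k} {V : Vec (Multiplication l n m) k} {f g} → Span V f → Span V g → Span V (λ A B → f A B - g A B)
    s ⊟ s′ = s ⊞ ⊟ s′

    span-mono : ∀ {k k′} {V : Vec (Multiplication l n m) k} {W : Vec (Multiplication l n m) k′} {f} →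
                (∀ {p} → p ∈ V → p ∈ W) → Span V f → Span W f
    span-mono V⊆W (gen p∈V)  = gen (V⊆W p∈V)
    span-mono V⊆W (s ⊞ s′)   = span-mono V⊆W s ⊞ span-mono V⊆W s′
    span-mono V⊆W (⊟ s)      = ⊟ span-mono V⊆W s
    span-mono V⊆W (resp f≈g s) = resp f≈g (span-mono V⊆W s)

    span-coefficients : ∀ {k} {V : Vec (Multiplication l n m) k} {f} → Span V f →
      Σ (Fin k → ℤ) λ γ → ∀ A B → f A B ≈ γ · (λ t → ⟦ lookup V t ⟧ₘ A B)
    span-coefficients {V = V} (gen {p} p∈V) = δ (Any.index p∈V) , λ A B → begin
      ⟦ p ⟧ₘ A B                                   ≡⟨ ≡.cong (λ q → ⟦ q ⟧ₘ A B) (lookup-index p∈V) ⟩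
      ⟦ lookup V (Any.index p∈V) ⟧ₘ A B            ≈⟨ δ-· (Any.index p∈V) (λ t → ⟦ lookup V t ⟧ₘ A B) ⟨
      δ (Any.index p∈V) · (λ t → ⟦ lookup V t ⟧ₘ A B) ∎
    span-coefficients {V = V} (s ⊞ s′) with span-coefficients s | span-coefficients s′
    ... | γ , f≈ | γ′ , g≈ = (λ t → γ t ℤ.+ γ′ t) , λ A B →
      trans (+-cong (f≈ A B) (g≈ A B)) (sym (·-homo-+ γ γ′ (λ t → ⟦ lookup V t ⟧ₘ A B)))
    span-coefficients {V = V} (⊟ s) with span-coefficients s
    ... | γ , f≈ = (λ t → ℤ.- γ t) , λ A B →
      trans (-‿cong (f≈ A B)) (sym (·-homo-‿ γ (λ t → ⟦ lookup V t ⟧ₘ A B)))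
    span-coefficients (resp f≈g s) with span-coefficients s
    ... | γ , f≈ = γ , λ A B → trans (sym (f≈g A B)) (f≈ A B)

    entry : Fin l → Fin m → Mat R l n → Mat R n m → Carrier
    entry i j A B = matMul R A B i j

  record Algorithm (l n m k : ℕ) : Set (c ⊔ ℓ) where
    field
      multiplications : Vec (Multiplication l n m) k
      entries         : ∀ i j → Span multiplications (entry i j)

  Algorithm⇒ComputableWith : ∀ {l n m k} → Algorithm l n m k → ComputableWith R l n m k
  Algorithm⇒ComputableWith {l} {n} {m} {k} 𝒜 = scheme , computes
    where
    open Algorithm 𝒜
    left right : Fin k → Form l n m
    left  t = proj₁ (lookup multiplications t)
    right t = proj₂ (lookup multiplications t)
    scheme : Scheme l n m k
    scheme = record
      { α  = λ t → coeffᴬ (left t)  ; β  = λ t → coeffᴮ (left t)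
      ; α' = λ t → coeffᴬ (right t) ; β' = λ t → coeffᴮ (right t)
      ; γ  = λ i j → proj₁ (span-coefficients (entries i j))
      }
    computes : Computes R scheme
    computes A B i j = trans (proj₂ (span-coefficients (entries i j)) A B)
      (sum-cong-≋ λ t → *-congˡ (sym (*-cong (linComb-coeff (left t) A B) (linComb-coeff (right t) A B))))

  module _ {l n m l′ n′ m′ : ℕ}
           (fi : Fin l → Fin l′) (fr : Fin n → Fin n′) (fj : Fin m → Fin m′) where

    pullᴬ : Mat R l′ n′ → Mat R l n
    pullᴬ A i r = A (fi i) (fr r)

    pullᴮ : Mat R n′ m′ → Mat R n m
    pullᴮ B r j = B (fr r) (fj j)

    ⟦rename⟧ : ∀ e A B → ⟦ rename fi fr fj e ⟧ A B ≡ ⟦ e ⟧ (pullᴬ A) (pullᴮ B)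
    ⟦rename⟧ (a i r) A B = ≡.refl
    ⟦rename⟧ (b r j) A B = ≡.refl
    ⟦rename⟧ (e ⊕ f) A B = ≡.cong₂ _+_ (⟦rename⟧ e A B) (⟦rename⟧ f A B)
    ⟦rename⟧ (⊝ e)   A B = ≡.cong -_ (⟦rename⟧ e A B)

    span-rename : ∀ {k} {V : Vec (Multiplication l n m) k} {f} → Span V f →
                  Span (map (renameₘ fi fr fj) V) (λ A B → f (pullᴬ A) (pullᴮ B))
    span-rename (gen {e , e′} p∈V) =
      resp (λ A B → reflexive (≡.cong₂ _*_ (⟦rename⟧ e A B) (⟦rename⟧ e′ A B))) (gen (∈-map⁺ _ p∈V))
    span-rename (s ⊞ s′)     = span-rename s ⊞ span-rename s′
    span-rename (⊟ s)        = ⊟ span-rename s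
    span-rename (resp f≈g s) = resp (λ A B → f≈g (pullᴬ A) (pullᴮ B)) (span-rename s)

  Algorithm-cast : ∀ {l n m k k′} → k ≡ k′ → Algorithm l n m k → Algorithm l n m k′
  Algorithm-cast ≡.refl 𝒜 = 𝒜

  infixr 5 _++ᴬ_

  _++ᴬ_ : ∀ {l n₁ n₂ m k₁ k₂} → Algorithm l n₁ m k₁ → Algorithm l n₂ m k₂ →
          Algorithm l (n₁ ℕ.+ n₂) m (k₁ ℕ.+ k₂)
  _++ᴬ_ {l} {n₁} {n₂} {m} {k₁} {k₂} 𝒜₁ 𝒜₂ = record { multiplications = V₁ ++ V₂ ; entries = entries }
    where
    module 𝒜₁ = Algorithm 𝒜₁
    module 𝒜₂ = Algorithm 𝒜₂
    V₁ : Vec (Multiplication l (n₁ ℕ.+ n₂) m) k₁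
    V₁ = map (renameₘ (λ i → i) (_↑ˡ n₂) (λ j → j)) 𝒜₁.multiplications
    V₂ : Vec (Multiplication l (n₁ ℕ.+ n₂) m) k₂
    V₂ = map (renameₘ (λ i → i) (n₁ ↑ʳ_) (λ j → j)) 𝒜₂.multiplications
    entries : ∀ i j → Span (V₁ ++ V₂) (entry i j)
    entries i j = resp (λ A B → sym (sum-↑ n₁ (λ r → A i r * B r j)))
      (span-mono ∈-++⁺ˡ (span-rename _ _ _ (𝒜₁.entries i j)) ⊞
       span-mono (∈-++⁺ʳ V₁) (span-rename _ _ _ (𝒜₂.entries i j)))

  shifted : ∀ {l n m k} c → Vec (Multiplication l n m) k → Vec (Multiplication l n (c ℕ.+ m)) k
  shifted c = map (renameₘ (λ i → i) (λ r → r) (c ↑ʳ_))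

  span-shifted : ∀ {l n m k k′} c (𝒜 : Algorithm l n m k) (W : Vec (Multiplication l n (c ℕ.+ m)) k′) i j →
                 Span (shifted c (Algorithm.multiplications 𝒜) ++ W) (entry i (c ↑ʳ j))
  span-shifted c 𝒜 W i j = span-mono ∈-++⁺ˡ (span-rename _ _ _ (Algorithm.entries 𝒜 i j))

  stack : ∀ {l m w k} p → Algorithm l 2 m w → Algorithm l 3 m k → Algorithm l (3 ℕ.+ p ℕ.* 2) m (p ℕ.* w ℕ.+ k)
  stack zero    𝒜₂ 𝒜₃ = 𝒜₃
  stack {w = w} {k} (suc p) 𝒜₂ 𝒜₃ =
    Algorithm-cast (≡.sym (ℕ.+-assoc w (p ℕ.* w) k)) (𝒜₂ ++ᴬ stack p 𝒜₂ 𝒜₃)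

  module Layout {l n m k r s : ℕ} (old : Vec (Multiplication l n m) k)
                (row : Fin l → Vec (Multiplication l n m) r) (sharedᵥ : Vec (Multiplication l n m) s) where

    V : Vec (Multiplication l n m) (k ℕ.+ (l ℕ.* r ℕ.+ s))
    V = old ++ (concat (tabulate row) ++ sharedᵥ)

    in-old : ∀ {p} → p ∈ old → p ∈ V
    in-old = ∈-++⁺ˡ

    in-row : ∀ i {p} → p ∈ row i → p ∈ V
    in-row i p∈ = ∈-++⁺ʳ old (∈-++⁺ˡ (concat⁺ (tabulate⁺ i p∈)))

    in-shared : ∀ {p} → p ∈ sharedᵥ → p ∈ V
    in-shared = ∈-++⁺ʳ old ∘ ∈-++⁺ʳ (concat (tabulate row))

  inner₂-column₀ : ∀ x₀ x₁ b₀ b₁ → x₁ * (x₀ + b₁) - x₀ * (x₁ - b₀) ≈ x₀ * b₀ + (x₁ * b₁ + 0#)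
  inner₂-column₀ = solve 4 (λ x₀ x₁ b₀ b₁ →
    x₁ :* (x₀ :+ b₁) :- x₀ :* (x₁ :- b₀) := x₀ :* b₀ :+ (x₁ :* b₁ :+ con (+ 0))) refl

  inner₂-column : ∀ x₀ x₁ b₀ b₀′ b₁′ →
    (x₀ + b₁′) * (x₁ + (b₀′ - b₀)) - x₀ * (x₁ - b₀) - b₁′ * (b₀′ - b₀) ≈ x₀ * b₀′ + (x₁ * b₁′ + 0#)
  inner₂-column = solve 5 (λ x₀ x₁ b₀ b₀′ b₁′ →
    (x₀ :+ b₁′) :* (x₁ :+ (b₀′ :- b₀)) :- x₀ :* (x₁ :- b₀) :- b₁′ :* (b₀′ :- b₀)
      := x₀ :* b₀′ :+ (x₁ :* b₁′ :+ con (+ 0))) refl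

  inner₂ : ∀ l m → Algorithm l 2 (suc m) (pairCost l (suc m))
  inner₂ l m = Algorithm-cast (inner₂-cost l m) (record { multiplications = V ; entries = entries })
    where
    row : Fin l → Vec (Multiplication l 2 (suc m)) (2 ℕ.+ m)
    row i = (a i 0F , a i 1F ⊖ b 0F 0F)
          ∷ (a i 1F , a i 0F ⊕ b 1F 0F)
          ∷ tabulate (λ j → a i 0F ⊕ b 1F (suc j) , a i 1F ⊕ (b 0F (suc j) ⊖ b 0F 0F))
    sharedᵥ : Vec (Multiplication l 2 (suc m)) m
    sharedᵥ = tabulate (λ j → b 1F (suc j) , b 0F (suc j) ⊖ b 0F 0F)
    open Layout [] row sharedᵥ
    entries : ∀ i j → Span V (entry i j)
    entries i 0F      = resp (λ A B → inner₂-column₀ (A i 0F) (A i 1F) (B 0F 0F) (B 1F 0F))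
      (gen (in-row i #1) ⊟ gen (in-row i #0))
    entries i (suc j) = resp (λ A B → inner₂-column (A i 0F) (A i 1F) (B 0F 0F) (B 0F (suc j)) (B 1F (suc j)))
      (gen (in-row i (there (there (∈-tabulate⁺ _ j)))) ⊟ gen (in-row i #0) ⊟ gen (in-shared (∈-tabulate⁺ _ j)))

  span-perturbation : ∀ {l n m k} {V : Vec (Multiplication l n m) k} (S : Fin n → Fin m) i r s u v →
    cross S i r s ∈ V → shared S r s ∈ V → perturbed S i r s u v ∈ V → sharedPerturbed S r s u v ∈ V →
    Span V (λ A B → A i r * ⟦ v ⟧ A B + A i s * ⟦ u ⟧ A B)
  span-perturbation S i r s u v cross∈ shared∈ perturbed∈ sharedPerturbed∈ =
    resp (λ A B → perturbation (A i r) (A i s) (B s (S r)) (B r (S s)) (⟦ u ⟧ A B) (⟦ v ⟧ A B))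
      (gen perturbed∈ ⊟ gen cross∈ ⊟ gen sharedPerturbed∈ ⊞ gen shared∈)
    where
    perturbation : ∀ x y P Q U V →
      (x - P + U) * (y - Q + V) - (x - P) * (y - Q) - (P - U) * (Q - V) + P * Q ≈ x * V + y * U
    perturbation = solve 6 (λ x y P Q U V →
      (x :- P :+ U) :* (y :- Q :+ V) :- (x :- P) :* (y :- Q) :- (P :- U) :* (Q :- V) :+ P :* Q
        := x :* V :+ y :* U) refl

  _∈ᴬ_ : ∀ {l n m k} → Multiplication l n m → Algorithm l n m k → Set
  p ∈ᴬ 𝒜 = p ∈ Algorithm.multiplications 𝒜

  record Anchored (l m k : ℕ) : Set (c ⊔ ℓ) where
    field
      algorithm : Algorithm l 3 m k
      anchor    : Fin 3 → Fin m
      cross₀₁   : ∀ i → cross anchor i 0F 1F ∈ᴬ algorithm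
      cross₀₂   : ∀ i → cross anchor i 0F 2F ∈ᴬ algorithm
      cross₁₂   : ∀ i → cross anchor i 1F 2F ∈ᴬ algorithm
      shared₀₁  : shared anchor 0F 1F ∈ᴬ algorithm
      shared₀₂  : shared anchor 0F 2F ∈ᴬ algorithm
      shared₁₂  : shared anchor 1F 2F ∈ᴬ algorithm

  square-column₀ : ∀ x₀ x₁ x₂ b₀₀ b₀₁ b₀₂ b₁₀ b₂₀ →
    x₀ * (x₁ + x₂ + b₀₀ - b₀₁ - b₀₂) - (x₀ - b₁₀) * (x₁ - b₀₁) - (x₀ - b₂₀) * (x₂ - b₀₂)
      + b₁₀ * b₀₁ + b₂₀ * b₀₂ ≈ x₀ * b₀₀ + (x₁ * b₁₀ + (x₂ * b₂₀ + 0#))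
  square-column₀ = solve 8 (λ x₀ x₁ x₂ b₀₀ b₀₁ b₀₂ b₁₀ b₂₀ →
    x₀ :* (x₁ :+ x₂ :+ b₀₀ :- b₀₁ :- b₀₂) :- (x₀ :- b₁₀) :* (x₁ :- b₀₁) :- (x₀ :- b₂₀) :* (x₂ :- b₀₂)
      :+ b₁₀ :* b₀₁ :+ b₂₀ :* b₀₂ := x₀ :* b₀₀ :+ (x₁ :* b₁₀ :+ (x₂ :* b₂₀ :+ con (+ 0)))) refl

  square-column₁ : ∀ x₀ x₁ x₂ b₀₁ b₁₀ b₁₁ b₁₂ b₂₁ →
    x₁ * (x₀ + x₂ + b₁₁ - b₁₀ - b₁₂) - (x₀ - b₁₀) * (x₁ - b₀₁) - (x₁ - b₂₁) * (x₂ - b₁₂)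
      + b₁₀ * b₀₁ + b₂₁ * b₁₂ ≈ x₀ * b₀₁ + (x₁ * b₁₁ + (x₂ * b₂₁ + 0#))
  square-column₁ = solve 8 (λ x₀ x₁ x₂ b₀₁ b₁₀ b₁₁ b₁₂ b₂₁ →
    x₁ :* (x₀ :+ x₂ :+ b₁₁ :- b₁₀ :- b₁₂) :- (x₀ :- b₁₀) :* (x₁ :- b₀₁) :- (x₁ :- b₂₁) :* (x₂ :- b₁₂)
      :+ b₁₀ :* b₀₁ :+ b₂₁ :* b₁₂ := x₀ :* b₀₁ :+ (x₁ :* b₁₁ :+ (x₂ :* b₂₁ :+ con (+ 0)))) refl

  square-column₂ : ∀ x₀ x₁ x₂ b₀₂ b₁₂ b₂₀ b₂₁ b₂₂ →
    x₂ * (x₀ + x₁ + b₂₂ - b₂₀ - b₂₁) - (x₀ - b₂₀) * (x₂ - b₀₂) - (x₁ - b₂₁) * (x₂ - b₁₂)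
      + b₂₀ * b₀₂ + b₂₁ * b₁₂ ≈ x₀ * b₀₂ + (x₁ * b₁₂ + (x₂ * b₂₂ + 0#))
  square-column₂ = solve 8 (λ x₀ x₁ x₂ b₀₂ b₁₂ b₂₀ b₂₁ b₂₂ →
    x₂ :* (x₀ :+ x₁ :+ b₂₂ :- b₂₀ :- b₂₁) :- (x₀ :- b₂₀) :* (x₂ :- b₀₂) :- (x₁ :- b₂₁) :* (x₂ :- b₁₂)
      :+ b₂₀ :* b₀₂ :+ b₂₁ :* b₁₂ := x₀ :* b₀₂ :+ (x₁ :* b₁₂ :+ (x₂ :* b₂₂ :+ con (+ 0)))) refl

  square : ∀ l → Anchored l 3 (l ℕ.* 6 ℕ.+ 3)
  square l = record
    { algorithm = record { multiplications = V ; entries = entries }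
    ; anchor    = S
    ; cross₀₁   = λ i → in-row i #0
    ; cross₀₂   = λ i → in-row i #1
    ; cross₁₂   = λ i → in-row i #2
    ; shared₀₁  = in-shared #0
    ; shared₀₂  = in-shared #1
    ; shared₁₂  = in-shared #2
    }
    where
    S : Fin 3 → Fin 3
    S r = r
    star : Fin l → Fin 3 → Fin 3 → Fin 3 → Multiplication l 3 3
    star i r s t = a i r , a i s ⊕ a i t ⊕ b r (S r) ⊖ b r (S s) ⊖ b r (S t)
    row : Fin l → Vec (Multiplication l 3 3) 6
    row i = cross S i 0F 1F ∷ cross S i 0F 2F ∷ cross S i 1F 2F
          ∷ star i 0F 1F 2F ∷ star i 1F 0F 2F ∷ star i 2F 0F 1F ∷ []
    sharedᵥ : Vec (Multiplication l 3 3) 3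
    sharedᵥ = shared S 0F 1F ∷ shared S 0F 2F ∷ shared S 1F 2F ∷ []
    open Layout [] row sharedᵥ
    entries : ∀ i j → Span V (entry i j)
    entries i 0F = resp (λ A B → square-column₀ (A i 0F) (A i 1F) (A i 2F) (B 0F 0F) (B 0F 1F) (B 0F 2F) (B 1F 0F) (B 2F 0F))
      (gen (in-row i #3) ⊟ gen (in-row i #0) ⊟ gen (in-row i #1) ⊞ gen (in-shared #0) ⊞ gen (in-shared #1))
    entries i 1F = resp (λ A B → square-column₁ (A i 0F) (A i 1F) (A i 2F) (B 0F 1F) (B 1F 0F) (B 1F 1F) (B 1F 2F) (B 2F 1F))
      (gen (in-row i #4) ⊟ gen (in-row i #0) ⊟ gen (in-row i #2) ⊞ gen (in-shared #0) ⊞ gen (in-shared #2))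
    entries i 2F = resp (λ A B → square-column₂ (A i 0F) (A i 1F) (A i 2F) (B 0F 2F) (B 1F 2F) (B 2F 0F) (B 2F 1F) (B 2F 2F))
      (gen (in-row i #5) ⊟ gen (in-row i #1) ⊟ gen (in-row i #2) ⊞ gen (in-shared #1) ⊞ gen (in-shared #2))

  extend₂-column₀ : ∀ x₀ x₁ x₂ b₀d b₀e b₁d b₂d →
    x₀ * (b₀d - b₀e) + x₁ * b₁d + (x₀ * b₀e + x₂ * b₂d) ≈ x₀ * b₀d + (x₁ * b₁d + (x₂ * b₂d + 0#))
  extend₂-column₀ = solve 7 (λ x₀ x₁ x₂ b₀d b₀e b₁d b₂d →
    x₀ :* (b₀d :- b₀e) :+ x₁ :* b₁d :+ (x₀ :* b₀e :+ x₂ :* b₂d)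
      := x₀ :* b₀d :+ (x₁ :* b₁d :+ (x₂ :* b₂d :+ con (+ 0)))) refl

  extend₂-column₁ : ∀ x₀ x₁ x₂ b₀e b₁e b₂d b₂e →
    x₁ * b₁e + x₂ * (b₂e - b₂d) + (x₀ * b₀e + x₂ * b₂d) ≈ x₀ * b₀e + (x₁ * b₁e + (x₂ * b₂e + 0#))
  extend₂-column₁ = solve 7 (λ x₀ x₁ x₂ b₀e b₁e b₂d b₂e →
    x₁ :* b₁e :+ x₂ :* (b₂e :- b₂d) :+ (x₀ :* b₀e :+ x₂ :* b₂d)
      := x₀ :* b₀e :+ (x₁ :* b₁e :+ (x₂ :* b₂e :+ con (+ 0)))) refl

  extend₂ : ∀ {l m k} → Anchored l m k → Anchored l (2 ℕ.+ m) (k ℕ.+ (l ℕ.* 3 ℕ.+ 3))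
  extend₂ {l} {m} {k} 𝒜 = record
    { algorithm = record { multiplications = V ; entries = entries }
    ; anchor    = T
    ; cross₀₁   = λ i → old (cross₀₁ i)
    ; cross₀₂   = λ i → old (cross₀₂ i)
    ; cross₁₂   = λ i → old (cross₁₂ i)
    ; shared₀₁  = old shared₀₁
    ; shared₀₂  = old shared₀₂
    ; shared₁₂  = old shared₁₂
    }
    where
    open Anchored 𝒜
    T : Fin 3 → Fin (2 ℕ.+ m)
    T r = 2 ↑ʳ anchor r
    d e : Fin (2 ℕ.+ m)
    d = 0F
    e = 1F
    u₀₁ v₀₁ u₀₂ v₀₂ u₁₂ v₁₂ : Form l 3 (2 ℕ.+ m)
    u₀₁ = b 1F d
    v₀₁ = b 0F d ⊖ b 0F e
    u₀₂ = b 2F d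
    v₀₂ = b 0F e
    u₁₂ = b 2F e ⊖ b 2F d
    v₁₂ = b 1F e
    row : Fin l → Vec (Multiplication l 3 (2 ℕ.+ m)) 3
    row i = perturbed T i 0F 1F u₀₁ v₀₁ ∷ perturbed T i 0F 2F u₀₂ v₀₂ ∷ perturbed T i 1F 2F u₁₂ v₁₂ ∷ []
    sharedᵥ : Vec (Multiplication l 3 (2 ℕ.+ m)) 3
    sharedᵥ = sharedPerturbed T 0F 1F u₀₁ v₀₁ ∷ sharedPerturbed T 0F 2F u₀₂ v₀₂ ∷ sharedPerturbed T 1F 2F u₁₂ v₁₂ ∷ []
    open Layout (shifted 2 (Algorithm.multiplications algorithm)) row sharedᵥ
    old : ∀ {p} → p ∈ᴬ algorithm → renameₘ (λ i → i) (λ r → r) (2 ↑ʳ_) p ∈ V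
    old = in-old ∘ ∈-map⁺ _
    pair₀₁ : ∀ i → Span V (λ A B → A i 0F * ⟦ v₀₁ ⟧ A B + A i 1F * ⟦ u₀₁ ⟧ A B)
    pair₀₁ i = span-perturbation T i 0F 1F u₀₁ v₀₁
      (old (cross₀₁ i)) (old shared₀₁) (in-row i #0) (in-shared #0)
    pair₀₂ : ∀ i → Span V (λ A B → A i 0F * ⟦ v₀₂ ⟧ A B + A i 2F * ⟦ u₀₂ ⟧ A B)
    pair₀₂ i = span-perturbation T i 0F 2F u₀₂ v₀₂
      (old (cross₀₂ i)) (old shared₀₂) (in-row i #1) (in-shared #1)
    pair₁₂ : ∀ i → Span V (λ A B → A i 1F * ⟦ v₁₂ ⟧ A B + A i 2F * ⟦ u₁₂ ⟧ A B)
    pair₁₂ i = span-perturbation T i 1F 2F u₁₂ v₁₂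
      (old (cross₁₂ i)) (old shared₁₂) (in-row i #2) (in-shared #2)
    entries : ∀ i j → Span V (entry i j)
    entries i 0F = resp (λ A B → extend₂-column₀ (A i 0F) (A i 1F) (A i 2F) (B 0F d) (B 0F e) (B 1F d) (B 2F d))
      (pair₀₁ i ⊞ pair₀₂ i)
    entries i 1F = resp (λ A B → extend₂-column₁ (A i 0F) (A i 1F) (A i 2F) (B 0F e) (B 1F e) (B 2F d) (B 2F e))
      (pair₁₂ i ⊞ pair₀₂ i)
    entries i (suc (suc j)) = span-shifted 2 algorithm _ i j

  extend₁-column₀ : ∀ x₀ x₁ x₂ P Q b₀f b₁f b₂f →
    x₁ * (x₀ + (b₁f - P)) - (x₀ - P) * (x₁ - Q) + P * Q + (x₀ * (b₀f - Q) + x₂ * b₂f)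
      ≈ x₀ * b₀f + (x₁ * b₁f + (x₂ * b₂f + 0#))
  extend₁-column₀ = solve 8 (λ x₀ x₁ x₂ P Q b₀f b₁f b₂f →
    x₁ :* (x₀ :+ (b₁f :- P)) :- (x₀ :- P) :* (x₁ :- Q) :+ P :* Q :+ (x₀ :* (b₀f :- Q) :+ x₂ :* b₂f)
      := x₀ :* b₀f :+ (x₁ :* b₁f :+ (x₂ :* b₂f :+ con (+ 0)))) refl

  extend₁ : ∀ {l m k} → Anchored l m k → Algorithm l 3 (1 ℕ.+ m) (k ℕ.+ (l ℕ.* 2 ℕ.+ 1))
  extend₁ {l} {m} {k} 𝒜 = record { multiplications = V ; entries = entries }
    where
    open Anchored 𝒜
    T : Fin 3 → Fin (1 ℕ.+ m)
    T r = 1 ↑ʳ anchor r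
    f : Fin (1 ℕ.+ m)
    f = 0F
    u v : Form l 3 (1 ℕ.+ m)
    u = b 2F f
    v = b 0F f ⊖ b 0F (T 1F)
    row : Fin l → Vec (Multiplication l 3 (1 ℕ.+ m)) 2
    row i = (a i 1F , a i 0F ⊕ (b 1F f ⊖ b 1F (T 0F))) ∷ perturbed T i 0F 2F u v ∷ []
    open Layout (shifted 1 (Algorithm.multiplications algorithm)) row (sharedPerturbed T 0F 2F u v ∷ [])
    old : ∀ {p} → p ∈ᴬ algorithm → renameₘ (λ i → i) (λ r → r) (1 ↑ʳ_) p ∈ V
    old = in-old ∘ ∈-map⁺ _
    entries : ∀ i j → Span V (entry i j)
    entries i 0F = resp (λ A B → extend₁-column₀ (A i 0F) (A i 1F) (A i 2F) (B 1F (T 0F)) (B 0F (T 1F)) (B 0F f) (B 1F f) (B 2F f))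
      (gen (in-row i #0) ⊟ gen (old (cross₀₁ i)) ⊞ gen (old shared₀₁) ⊞
       span-perturbation T i 0F 2F u v (old (cross₀₂ i)) (old shared₀₂)
         (in-row i #1) (in-shared #0))
    entries i (suc j) = span-shifted 1 algorithm _ i j

  anchored : ∀ l q → Anchored l (3 ℕ.+ q ℕ.* 2) (anchoredCost l q)
  anchored l zero    = square l
  anchored l (suc q) = extend₂ (anchored l q)

open import Data.Nat using (ℕ; _+_; _*_; _∸_; _≤_)
open import Data.Nat.DivMod using (_/_; _%_)
open import Relation.Binary.PropositionalEquality using (_≡_)
open import Data.Product using (_×_)

mainTheorem3 : ∀ {c ℓ : Level} (R : CommutativeRing c ℓ) (n l m : ℕ) →
    3 ≤ n → n % 2 ≡ 1 → 1 ≤ l → 3 ≤ m →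
    ((m % 2 ≡ 1 → ComputableWith R l n m ((n * (l * m + l + m ∸ 1)) / 2)) ×
     (m % 2 ≡ 0 → ComputableWith R l n m ((n * (l * m + l + m ∸ 1) + l ∸ 1) / 2)))
mainTheorem3 R n l m 3≤n n-odd 1≤l 3≤m with odd≥3⇒3+2p n n-odd 3≤n
... | p , ≡.refl = m-odd-case , m-even-case
  where
  open Algorithms R
  m-odd-case : m % 2 ≡ 1 → ComputableWith R l (3 + p * 2) m (((3 + p * 2) * pairCost l m) / 2)
  m-odd-case m-odd with odd≥3⇒3+2p m m-odd 3≤m
  ... | q , ≡.refl = Algorithm⇒ComputableWith
    (Algorithm-cast (stackCost-odd p (twice-anchoredCost l q))
      (stack p (inner₂ l (2 + q * 2)) (Anchored.algorithm (anchored l q))))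
  m-even-case : m % 2 ≡ 0 → ComputableWith R l (3 + p * 2) m (((3 + p * 2) * pairCost l m + l ∸ 1) / 2)
  m-even-case m-even with even≥3⇒4+2q m m-even 3≤m
  ... | q , ≡.refl = Algorithm⇒ComputableWith
    (Algorithm-cast (stackCost-even p 1≤l (twice-extendedCost l q 1≤l))
      (stack p (inner₂ l (3 + q * 2)) (extend₁ (anchored l q))))
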